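{- Let $G$ be a graph with no isolated vertices and let $w_v,w_e$ be nonnegative weights with $w_e\geq 2w_v$. Then every minimum vertex cover of $G$ is a minimum-weight mixed dominating set of $G$.
   Context: In a graph $G=(V,E)$, a vertex dominates itself, all its neighbours and all edges incident to it; an edge dominates itself, its two endpoints and all edges sharing an endpoint with it. A mixed dominating set is a set $D\subseteq V\cup E$ such that every vertex and every edge is dominated by at least one element of $D$; its weight is $w(D)=w_v|D\cap V|+w_e|D\cap E|$. A vertex cover is a set of vertices containing at least one endpoint of every edge; a minimum vertex cover has minimum cardinality.
   Formalization: The weights $w_v$ and $w_e$ are nonnegative rationals. -}

module Defs where

open import Data.Nat as ℕ using (ℕ)
open import Data.Integer using (+_)
open import Data.Bool using (Bool; true; false; if_then_else_)
open import Data.Fin using (Fin; _<_)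
open import Data.Fin.Subset using (Subset; _∈_; ∣_∣)
open import Data.List using (map; allFin)
open import Data.Nat.ListAction using (sum)
open import Data.Product using (_×_; ∃; ∃-syntax; _,_)
open import Data.Sum using (_⊎_)
open import Data.Rational as ℚ using (ℚ; _/_; _*_; _+_; _≤_)
open import Relation.Binary.PropositionalEquality using (_≡_)
open import Relation.Nullary using (¬_)

record Graph (n : ℕ) : Set where
  field
    adj    : Fin n → Fin n → Bool
    sym    : ∀ u v → adj u v ≡ adj v u
    irrefl : ∀ v → adj v v ≡ false
open Graph public

module _ {n : ℕ} (G : Graph n) where

  -- edges {i,j} are represented canonically by the ordered pair (i , j) with i < j
  Edge : Fin n → Fin n → Set
  Edge i j = i < j × adj G i j ≡ true

  NoIsolated : Set
  NoIsolated = ∀ v → ∃[ u ] adj G v u ≡ true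

  ESet : Set
  ESet = Fin n → Fin n → Bool

  ValidESet : ESet → Set
  ValidESet F = ∀ i j → F i j ≡ true → Edge i j

  record Mixed : Set where
    constructor mixed
    field
      verts : Subset n
      edges : ESet
  open Mixed public

  DomV : Mixed → Fin n → Set
  DomV D v =
    v ∈ verts D
    ⊎ (∃[ u ] (adj G u v ≡ true × u ∈ verts D))
    ⊎ (∃[ i ] ∃[ j ] (edges D i j ≡ true × (v ≡ i ⊎ v ≡ j)))

  DomE : Mixed → Fin n → Fin n → Set
  DomE D a b =
    a ∈ verts D ⊎ b ∈ verts D
    ⊎ (∃[ i ] ∃[ j ] (edges D i j ≡ true ×
         (i ≡ a ⊎ i ≡ b ⊎ j ≡ a ⊎ j ≡ b)))

  IsMixedDominating : Mixed → Set
  IsMixedDominating D =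
    ValidESet (edges D)
    × (∀ v → DomV D v)
    × (∀ a b → Edge a b → DomE D a b)

  countE : ESet → ℕ
  countE F = sum (map (λ i → sum (map (λ j → if F i j then 1 else 0) (allFin n))) (allFin n))

  weight : ℚ → ℚ → Mixed → ℚ
  weight wv we D = wv * ((+ ∣ verts D ∣) / 1) + we * ((+ countE (edges D)) / 1)

  IsMinWeightMDS : ℚ → ℚ → Mixed → Set
  IsMinWeightMDS wv we D =
    IsMixedDominating D × (∀ D′ → IsMixedDominating D′ → weight wv we D ≤ weight wv we D′)

  IsVertexCover : Subset n → Set
  IsVertexCover S = ∀ i j → Edge i j → i ∈ S ⊎ j ∈ S

  IsMinVertexCover : Subset n → Set
  IsMinVertexCover S = IsVertexCover S × (∀ S′ → IsVertexCover S′ → ∣ S ∣ ℕ.≤ ∣ S′ ∣)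

  emptyE : ESet
  emptyE _ _ = false

  asMixed : Subset n → Mixed
  asMixed S = mixed S emptyE

-- Let S be a minimum vertex cover and D any mixed dominating set.
--   * S, viewed as a mixed set without edges, dominates every edge (it is a
--     cover) and every vertex v (v has a neighbour u, and the edge uv puts v
--     or u into S).
--   * The vertices of D together with the endpoints of the edges of D form
--     a vertex cover: an edge dominated by an edge of D shares an endpoint
--     with it.  This cover has at most |D ∩ V| + 2|D ∩ E| vertices, so by
--     minimality |S| ≤ |D ∩ V| + 2|D ∩ E|.
--   * Multiplying by w_v and using 2 w_v ≤ w_e gives w(S) ≤ w(D).

module Submission where

open import Defs
open import Data.Nat using (ℕ)
open import Data.Fin.Subset using (Subset)
open import Data.Rational using (ℚ; 0ℚ; _≤_; _*_; _/_)
open import Data.Integer using (+_)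

import Data.Nat as ℕ
import Data.Nat.Properties as ℕ
import Data.Integer as ℤ
import Data.Integer.Properties as ℤ
open import Data.Rational using (mkℚ; 1ℚ; _+_; *≤*; NonNegative; nonNegative)
open import Data.Rational.Properties
  using (normalize-coprime; normalize-nonNeg; /-cong; *-zeroʳ; +-identityʳ; +-monoʳ-≤;
         *-monoˡ-≤-nonNeg; *-monoʳ-≤-nonNeg; module ≤-Reasoning)
open import Data.Rational.Solver using (module +-*-Solver)
open import Data.Nat.Coprimality using (Coprime; 1-coprimeTo)
import Data.Nat.Coprimality as Coprime
open import Data.Fin using (Fin)
open import Data.Fin.Properties using (<-cmp)
open import Data.Fin.Subset using (_∪_; ⊥; ⁅_⁆; ⋃; ∣_∣; inside; outside; _∈_)
open import Data.Fin.Subset.Properties using (x∈p∪q⁺; ∣⊥∣≡0; ∣⁅x⁆∣≡1; x∈⁅x⁆)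
open import Data.Vec using (_∷_; [])
open import Data.List using ([]; _∷_; map; allFin)
open import Data.List.Relation.Unary.Any using (here; there)
import Data.List.Membership.Propositional as List
open import Data.List.Membership.Propositional.Properties using (∈-allFin)
open import Data.Nat.ListAction using (sum)
open import Data.Bool using (true; false; if_then_else_)
open import Data.Product using (_×_; _,_)
open import Data.Sum using (_⊎_; inj₁; inj₂)
open import Relation.Binary.Definitions using (tri<; tri≈; tri>)
open import Relation.Binary.PropositionalEquality as ≡
  using (_≡_; refl; trans; cong; cong₂; subst; subst₂; module ≡-Reasoning)

∣p∪q∣≤∣p∣+∣q∣ : ∀ {n} (p q : Subset n) → ∣ p ∪ q ∣ ℕ.≤ ∣ p ∣ ℕ.+ ∣ q ∣
∣p∪q∣≤∣p∣+∣q∣ []            []            = ℕ.z≤n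
∣p∪q∣≤∣p∣+∣q∣ (inside ∷ p)  (inside ∷ q)  =
  ℕ.s≤s (ℕ.≤-trans (∣p∪q∣≤∣p∣+∣q∣ p q) (ℕ.+-monoʳ-≤ ∣ p ∣ (ℕ.n≤1+n ∣ q ∣)))
∣p∪q∣≤∣p∣+∣q∣ (inside ∷ p)  (outside ∷ q) = ℕ.s≤s (∣p∪q∣≤∣p∣+∣q∣ p q)
∣p∪q∣≤∣p∣+∣q∣ (outside ∷ p) (inside ∷ q)  =
  ℕ.≤-trans (ℕ.s≤s (∣p∪q∣≤∣p∣+∣q∣ p q)) (ℕ.≤-reflexive (≡.sym (ℕ.+-suc ∣ p ∣ ∣ q ∣)))
∣p∪q∣≤∣p∣+∣q∣ (outside ∷ p) (outside ∷ q) = ∣p∪q∣≤∣p∣+∣q∣ p q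

module _ {n : ℕ} {A : Set} (g : A → Subset n) where

  ∣⋃∣≤ : (k : ℕ) (h : A → ℕ) → (∀ x → ∣ g x ∣ ℕ.≤ k ℕ.* h x) →
         ∀ xs → ∣ ⋃ (map g xs) ∣ ℕ.≤ k ℕ.* sum (map h xs)
  ∣⋃∣≤ k h bound []       = ℕ.≤-trans (ℕ.≤-reflexive (∣⊥∣≡0 n)) ℕ.z≤n
  ∣⋃∣≤ k h bound (x ∷ xs) = begin
    ∣ g x ∪ ⋃ (map g xs) ∣                     ≤⟨ ∣p∪q∣≤∣p∣+∣q∣ (g x) (⋃ (map g xs)) ⟩
    ∣ g x ∣ ℕ.+ ∣ ⋃ (map g xs) ∣               ≤⟨ ℕ.+-mono-≤ (bound x) (∣⋃∣≤ k h bound xs) ⟩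
    k ℕ.* h x ℕ.+ k ℕ.* sum (map h xs)         ≡⟨ ℕ.*-distribˡ-+ k (h x) (sum (map h xs)) ⟨
    k ℕ.* sum (map h (x ∷ xs))                 ∎
    where open ℕ.≤-Reasoning

  ∈⋃ : ∀ {x xs v} → x List.∈ xs → v ∈ g x → v ∈ ⋃ (map g xs)
  ∈⋃ (here refl) v∈gx = x∈p∪q⁺ (inj₁ v∈gx)
  ∈⋃ (there x∈xs) v∈gx = x∈p∪q⁺ (inj₂ (∈⋃ x∈xs v∈gx))

module _ {n : ℕ} (G : Graph n) where

  [_∋_,_] : ESet G → Fin n → Fin n → ℕ
  [ F ∋ i , j ] = if F i j then 1 else 0

  pairEnds : ESet G → Fin n → Fin n → Subset n
  pairEnds F i j = if F i j then ⁅ i ⁆ ∪ ⁅ j ⁆ else ⊥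

  ∣pairEnds∣≤ : ∀ F i j → ∣ pairEnds F i j ∣ ℕ.≤ 2 ℕ.* [ F ∋ i , j ]
  ∣pairEnds∣≤ F i j with F i j
  ... | true  = ℕ.≤-trans (∣p∪q∣≤∣p∣+∣q∣ ⁅ i ⁆ ⁅ j ⁆)
                          (ℕ.≤-reflexive (cong₂ ℕ._+_ (∣⁅x⁆∣≡1 i) (∣⁅x⁆∣≡1 j)))
  ... | false = ℕ.≤-reflexive (∣⊥∣≡0 n)

  endpoints : ESet G → Subset n
  endpoints F = ⋃ (map (λ i → ⋃ (map (pairEnds F i) (allFin n))) (allFin n))

  ∣endpoints∣≤2·countE : ∀ F → ∣ endpoints F ∣ ℕ.≤ 2 ℕ.* countE G F
  ∣endpoints∣≤2·countE F =
    ∣⋃∣≤ _ 2 _ (λ i → ∣⋃∣≤ (pairEnds F i) 2 _ (∣pairEnds∣≤ F i) (allFin n)) (allFin n)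

  ∈endpoints : ∀ F {i j} → F i j ≡ true → i ∈ endpoints F × j ∈ endpoints F
  ∈endpoints F {i} {j} ij∈F = inEndpoints (x∈p∪q⁺ (inj₁ (x∈⁅x⁆ i)))
                            , inEndpoints (x∈p∪q⁺ (inj₂ (x∈⁅x⁆ j)))
    where
    inEndpoints : ∀ {v} → v ∈ ⁅ i ⁆ ∪ ⁅ j ⁆ → v ∈ endpoints F
    inEndpoints {v} v∈ij = ∈⋃ _ (∈-allFin i) (∈⋃ (pairEnds F i) (∈-allFin j) v∈pair)
      where
      v∈pair : v ∈ pairEnds F i j
      v∈pair rewrite ij∈F = v∈ij

  countE-emptyE : countE G (emptyE G) ≡ 0
  countE-emptyE = sumZero (λ _ → sumZero (λ _ → refl) (allFin n)) (allFin n)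
    where
    sumZero : ∀ {f : Fin n → ℕ} → (∀ i → f i ≡ 0) → ∀ is → sum (map f is) ≡ 0
    sumZero f≡0 []       = refl
    sumZero f≡0 (i ∷ is) = cong₂ ℕ._+_ (f≡0 i) (sumZero f≡0 is)

  cover-adjacent : ∀ {S} → IsVertexCover G S →
                   ∀ {u v} → adj G u v ≡ true → u ∈ S ⊎ v ∈ S
  cover-adjacent cover {u} {v} uv with <-cmp u v
  ... | tri< u<v _ _ = cover u v (u<v , uv)
  ... | tri≈ _ refl _ with trans (≡.sym uv) (irrefl G u)
  ...   | ()
  cover-adjacent cover {u} {v} uv | tri> _ _ v<u with cover v u (v<u , trans (Graph.sym G v u) uv)
  ...   | inj₁ v∈S = inj₂ v∈S
  ...   | inj₂ u∈S = inj₁ u∈S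

  cover⇒dominating : NoIsolated G → ∀ {S} → IsVertexCover G S →
                     IsMixedDominating G (asMixed G S)
  cover⇒dominating noIsolated {S} cover = (λ _ _ ()) , dominatesVertex , dominatesEdge
    where
    dominatesVertex : ∀ v → DomV G (asMixed G S) v
    dominatesVertex v with noIsolated v
    ... | u , vu with cover-adjacent cover vu
    ...   | inj₁ v∈S = inj₁ v∈S
    ...   | inj₂ u∈S = inj₂ (inj₁ (u , trans (Graph.sym G u v) vu , u∈S))

    dominatesEdge : ∀ a b → Edge G a b → DomE G (asMixed G S) a b
    dominatesEdge a b ab with cover a b ab
    ... | inj₁ a∈S = inj₁ a∈S
    ... | inj₂ b∈S = inj₂ (inj₁ b∈S)

  coverOf : Mixed G → Subset n
  coverOf D = verts D ∪ endpoints (edges D)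

  dominating⇒cover : ∀ D → IsMixedDominating G D → IsVertexCover G (coverOf D)
  dominating⇒cover D (_ , _ , dominatesEdge) a b ab with dominatesEdge a b ab
  ... | inj₁ a∈D        = inj₁ (x∈p∪q⁺ (inj₁ a∈D))
  ... | inj₂ (inj₁ b∈D) = inj₂ (x∈p∪q⁺ (inj₁ b∈D))
  ... | inj₂ (inj₂ (i , j , ij∈D , touches)) with ∈endpoints (edges D) ij∈D | touches
  ...   | i∈ , _ | inj₁ refl                 = inj₁ (x∈p∪q⁺ (inj₂ i∈))
  ...   | i∈ , _ | inj₂ (inj₁ refl)          = inj₂ (x∈p∪q⁺ (inj₂ i∈))
  ...   | _ , j∈ | inj₂ (inj₂ (inj₁ refl))   = inj₁ (x∈p∪q⁺ (inj₂ j∈))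
  ...   | _ , j∈ | inj₂ (inj₂ (inj₂ refl))   = inj₂ (x∈p∪q⁺ (inj₂ j∈))

  minCover≤ : ∀ {S} → IsMinVertexCover G S → ∀ D → IsMixedDominating G D →
              ∣ S ∣ ℕ.≤ ∣ verts D ∣ ℕ.+ 2 ℕ.* countE G (edges D)
  minCover≤ {S} (_ , minimal) D dominating = begin
    ∣ S ∣                                    ≤⟨ minimal (coverOf D) (dominating⇒cover D dominating) ⟩
    ∣ coverOf D ∣                            ≤⟨ ∣p∪q∣≤∣p∣+∣q∣ (verts D) (endpoints (edges D)) ⟩
    ∣ verts D ∣ ℕ.+ ∣ endpoints (edges D) ∣   ≤⟨ ℕ.+-monoʳ-≤ ∣ verts D ∣ (∣endpoints∣≤2·countE (edges D)) ⟩
    ∣ verts D ∣ ℕ.+ 2 ℕ.* countE G (edges D) ∎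
    where open ℕ.≤-Reasoning

⟦_⟧ : ℕ → ℚ
⟦ a ⟧ = (+ a) / 1

coprimeTo1 : ∀ a → Coprime a 1
coprimeTo1 a = Coprime.sym (1-coprimeTo a)

⟦⟧-normal : ∀ a → ⟦ a ⟧ ≡ mkℚ (+ a) 0 (coprimeTo1 a)
⟦⟧-normal a = normalize-coprime (coprimeTo1 a)

⟦⟧-nonNeg : ∀ a → NonNegative ⟦ a ⟧
⟦⟧-nonNeg a = normalize-nonNeg a 1

⟦⟧-mono : ∀ {a b} → a ℕ.≤ b → ⟦ a ⟧ ≤ ⟦ b ⟧
⟦⟧-mono {a} {b} a≤b rewrite ⟦⟧-normal a | ⟦⟧-normal b =
  *≤* (subst₂ ℤ._≤_ (≡.sym (ℤ.*-identityʳ (+ a))) (≡.sym (ℤ.*-identityʳ (+ b))) (ℤ.+≤+ a≤b))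

⟦⟧-+ : ∀ a b → ⟦ a ℕ.+ b ⟧ ≡ ⟦ a ⟧ + ⟦ b ⟧
⟦⟧-+ a b = begin
  (+ (a ℕ.+ b)) / 1                         ≡⟨ /-cong numerators refl ⟩
  (+ a ℤ.* + 1 ℤ.+ + b ℤ.* + 1) / (1 ℕ.* 1) ≡⟨⟩
  mkℚ (+ a) 0 (coprimeTo1 a) + mkℚ (+ b) 0 (coprimeTo1 b) ≡⟨ cong₂ _+_ (⟦⟧-normal a) (⟦⟧-normal b) ⟨
  ⟦ a ⟧ + ⟦ b ⟧                             ∎
  where
  open ≡-Reasoning
  numerators : + (a ℕ.+ b) ≡ + a ℤ.* + 1 ℤ.+ + b ℤ.* + 1
  numerators = ≡.sym (cong₂ ℤ._+_ (ℤ.*-identityʳ (+ a)) (ℤ.*-identityʳ (+ b)))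

-- Weight comparison: if s ≤ a + 2c then, since each edge may be traded for
-- two vertices (2 w_v ≤ w_e), s vertices weigh at most a vertices and c edges.
weight-trade : ∀ wv we → 0ℚ ≤ wv → ((+ 2) / 1) * wv ≤ we →
               ∀ s a c → s ℕ.≤ a ℕ.+ 2 ℕ.* c →
               wv * ⟦ s ⟧ ≤ wv * ⟦ a ⟧ + we * ⟦ c ⟧
weight-trade wv we 0≤wv 2wv≤we s a c s≤a+2c = begin
  wv * ⟦ s ⟧                            ≤⟨ *-monoˡ-≤-nonNeg wv {{nonNegative 0≤wv}} (⟦⟧-mono s≤a+2c) ⟩
  wv * ⟦ a ℕ.+ 2 ℕ.* c ⟧               ≡⟨ cong (wv *_) split ⟩
  wv * (⟦ a ⟧ + (⟦ c ⟧ + ⟦ c ⟧))        ≡⟨ double wv ⟦ a ⟧ ⟦ c ⟧ ⟩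
  wv * ⟦ a ⟧ + (((+ 2) / 1) * wv) * ⟦ c ⟧ ≤⟨ +-monoʳ-≤ (wv * ⟦ a ⟧) (*-monoʳ-≤-nonNeg ⟦ c ⟧ {{⟦⟧-nonNeg c}} 2wv≤we) ⟩
  wv * ⟦ a ⟧ + we * ⟦ c ⟧               ∎
  where
  open ≤-Reasoning
  split : ⟦ a ℕ.+ 2 ℕ.* c ⟧ ≡ ⟦ a ⟧ + (⟦ c ⟧ + ⟦ c ⟧)
  split = trans (⟦⟧-+ a (2 ℕ.* c)) (cong (_+_ ⟦ a ⟧)
            (trans (⟦⟧-+ c (c ℕ.+ 0)) (cong (λ m → ⟦ c ⟧ + ⟦ m ⟧) (ℕ.+-identityʳ c))))
  double : ∀ w x y → w * (x + (y + y)) ≡ w * x + (((+ 2) / 1) * w) * y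
  double = solve 3 (λ w x y → w :* (x :+ (y :+ y)) := w :* x :+ ((con 1ℚ :+ con 1ℚ) :* w) :* y) refl
    where open +-*-Solver

weight-asMixed : ∀ {n} (G : Graph n) wv we (S : Subset n) →
                 weight G wv we (asMixed G S) ≡ wv * ⟦ ∣ S ∣ ⟧
weight-asMixed G wv we S = begin
  wv * ⟦ ∣ S ∣ ⟧ + we * ⟦ countE G (emptyE G) ⟧ ≡⟨ cong (λ m → wv * ⟦ ∣ S ∣ ⟧ + we * ⟦ m ⟧) (countE-emptyE G) ⟩
  wv * ⟦ ∣ S ∣ ⟧ + we * 0ℚ                      ≡⟨ cong (_+_ (wv * ⟦ ∣ S ∣ ⟧)) (*-zeroʳ we) ⟩
  wv * ⟦ ∣ S ∣ ⟧ + 0ℚ                           ≡⟨ +-identityʳ (wv * ⟦ ∣ S ∣ ⟧) ⟩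
  wv * ⟦ ∣ S ∣ ⟧                                ∎
  where open ≡-Reasoning

lemma5 : (n : ℕ) (G : Graph n) → NoIsolated G →
    (wv we : ℚ) → 0ℚ ≤ wv → 0ℚ ≤ we → ((+ 2) / 1) * wv ≤ we →
    (S : Subset n) → IsMinVertexCover G S →
    IsMinWeightMDS G wv we (asMixed G S)
lemma5 n G noIsolated wv we 0≤wv _ 2wv≤we S minCover@(cover , _) =
  cover⇒dominating G noIsolated cover , lighter
  where
  lighter : ∀ D → IsMixedDominating G D → weight G wv we (asMixed G S) ≤ weight G wv we D
  lighter D dominating =
    subst (_≤ weight G wv we D) (≡.sym (weight-asMixed G wv we S))
      (weight-trade wv we 0≤wv 2wv≤we ∣ S ∣ ∣ verts D ∣ (countE G (edges D))
        (minCover≤ G minCover D dominating))
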